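{- Let $G$ be a graph and $k$ a positive integer. Then $G$ is $k$-choosable if and only if $G$ is $C$-colorable for every consistent $k$-correspondence assignment $C$ for $G$.
   Context: All graphs are finite and simple; $[k]=\{1,\dots,k\}$. Fix an arbitrary orientation $\vec G$ of $G$. A $k$-correspondence assignment for $G$ is a function $C$ assigning to every edge $e\in E(\vec G)$ an injective, not necessarily total, function $C_e:[k]\to[k]$ (i.e. $C_e$ is an injective function from a subset $\mathrm{dom}(C_e)\subseteq[k]$ into $[k]$). A $C$-coloring of $G$ is a function $f:V(G)\to[k]$ such that for every directed edge $e=uv\in E(\vec G)$, either $f(u)\notin\mathrm{dom}(C_e)$ or $C_e(f(u))\ne f(v)$. For $uv\in E(\vec G)$ set $C_{vu}=C_{uv}^{ -1}$. For injective partial functions $A,B$ on $[k]$, $A\circ B$ is the injective partial function with domain $\{c\in\mathrm{dom}(A): A(c)\in\mathrm{dom}(B)\}$ and $(A\circ B)(c)=B(A(c))$. For a walk $W=v_1v_2\dots v_m$ let $C_W=C_{v_1v_2}\circ\dots\circ C_{v_{m-1}v_m}$. A walk is closed if $v_1=v_m$. $C$ is consistent on a closed walk $W$ if $C_W(c)=c$ for every $c\in\mathrm{dom}(C_W)$, and $C$ is consistent if it is consistent on every closed walk in $G$. A graph is $k$-choosable if for every assignment of lists of size $k$ to its vertices it has a proper coloring choosing each vertex's color from its list. -}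

module Defs where

open import Data.Nat using (ℕ; _≤_)
open import Data.Fin using (Fin)
open import Data.Maybe using (Maybe; just)
open import Data.List using (List; length)
open import Data.List.Membership.Propositional using (_∈_)
open import Data.List.Relation.Unary.Unique.Propositional using (Unique)
open import Data.Product using (_×_; Σ; _,_)
open import Data.Sum using (_⊎_)
open import Relation.Binary.PropositionalEquality using (_≡_; _≢_)

-- A finite simple graph together with a fixed (arbitrary) orientation:
-- vertices Fin n, edges Fin m, edge e is oriented from tail e to head e.
record OGraph : Set where
  field
    n    : ℕ
    m    : ℕ
    tail : Fin m → Fin n
    head : Fin m → Fin n
    loopless : ∀ e → tail e ≢ head e
    noParallel : ∀ e e′ →
      ((tail e ≡ tail e′ × head e ≡ head e′) ⊎ (tail e ≡ head e′ × head e ≡ tail e′)) →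
      e ≡ e′

open OGraph public

record PartialInj (k : ℕ) : Set where
  field
    fun : Fin k → Maybe (Fin k)
    inj : ∀ a b c → fun a ≡ just c → fun b ≡ just c → a ≡ b

open PartialInj public

CorrAssignment : OGraph → ℕ → Set
CorrAssignment G k = Fin (m G) → PartialInj k

data Walk (G : OGraph) : Fin (n G) → Fin (n G) → Set where
  [] : ∀ {u} → Walk G u u
  fwd : ∀ {v} (e : Fin (m G)) → Walk G (head G e) v → Walk G (tail G e) v
  bwd : ∀ {v} (e : Fin (m G)) → Walk G (tail G e) v → Walk G (head G e) v

-- WalkMap C W c d  means  C_W(c) = d  (c ∈ dom C_W), where along an edge
-- traversed against its orientation the inverse C_{vu} = C_{uv}⁻¹ is used.
data WalkMap {G : OGraph} {k : ℕ} (C : CorrAssignment G k) :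
       ∀ {u v} → Walk G u v → Fin k → Fin k → Set where
  []  : ∀ {u} {c} → WalkMap C ([] {u = u}) c c
  fwd : ∀ {v} {e} {W : Walk G (head G e) v} {c c′ d} →
        fun (C e) c ≡ just c′ → WalkMap C W c′ d → WalkMap C (fwd e W) c d
  bwd : ∀ {v} {e} {W : Walk G (tail G e) v} {c c′ d} →
        fun (C e) c′ ≡ just c → WalkMap C W c′ d → WalkMap C (bwd e W) c d

Consistent : {G : OGraph} {k : ℕ} → CorrAssignment G k → Set
Consistent {G} C = ∀ (u : Fin (n G)) (W : Walk G u u) c d → WalkMap C W c d → d ≡ c

IsCColoring : {G : OGraph} {k : ℕ} → CorrAssignment G k → (Fin (n G) → Fin k) → Set
IsCColoring {G} C f = ∀ e → fun (C e) (f (tail G e)) ≢ just (f (head G e))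

CColorable : {G : OGraph} {k : ℕ} → CorrAssignment G k → Set
CColorable {G} {k} C = Σ (Fin (n G) → Fin k) (IsCColoring {G} {k} C)

Choosable : OGraph → ℕ → Set
Choosable G k =
  ∀ (L : Fin (n G) → List ℕ) →
  (∀ v → Unique (L v)) → (∀ v → length (L v) ≡ k) →
  Σ (Fin (n G) → ℕ) λ f → (∀ v → f v ∈ L v) × (∀ e → f (tail G e) ≢ f (head G e))

module Submission where

-- Both directions go through LABELLINGS: maps  lab : V → Fin k → ℕ  giving
-- each pair (vertex v, colour c) a "global colour" lab v c.  A labelling is
-- faithful if every lab v is injective, and it respects C if C_e(c) = d
-- implies lab (tail e) c ≡ lab (head e) d.
--
--  * (⇒) A faithful labelling respecting C turns the lists  lab v [k]  into a
--    list assignment; a proper list colouring pulls back to a C-colouring.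
--    Every consistent C has such a labelling: start from an injective
--    labelling and, for every edge e and colour c with C_e(c) = d, identify
--    the labels of (tail e, c) and (head e, d).  The invariant is that equal
--    labels only occur on pairs linked by a walk W with C_W(c) = d; by
--    consistency this keeps every lab v injective.
--  * (⇐) Lists of k distinct colours give a faithful labelling (list lookup).
--    It induces the correspondence "C_e(c) = d iff lab (tail e) c ≡
--    lab (head e) d", which preserves labels along walks, hence is
--    consistent, and whose colourings are exactly proper list colourings.

open import Defs
open import Data.Nat using (ℕ; _≤_)
open import Data.Nat.Properties using (_≟_)
open import Data.Fin using (Fin; zero; suc; cast; combine; toℕ)
open import Data.Fin.Properties using (any?; combine-injective; toℕ-cast; toℕ-injective)
open import Data.Maybe using (Maybe; just; nothing)
open import Data.List using (List; []; _∷_; length; lookup; map; allFin; cartesianProduct)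
open import Data.List.Properties using (length-map; length-tabulate)
open import Data.List.Membership.Propositional using (_∈_)
open import Data.List.Membership.Propositional.Properties
  using (∈-lookup; ∈-map⁻; ∈-allFin; ∈-cartesianProduct⁺)
open import Data.List.Relation.Unary.Any using (here; there)
open import Data.List.Relation.Unary.All as All using ()
open import Data.List.Relation.Unary.AllPairs using (_∷_)
open import Data.List.Relation.Unary.Unique.Propositional using (Unique)
open import Data.List.Relation.Unary.Unique.Propositional.Properties using (map⁺; allFin⁺)
open import Data.Product using (Σ; ∃; _×_; _,_; proj₁; proj₂)
open import Data.Sum using (_⊎_; inj₁; inj₂)
open import Data.Empty using (⊥-elim)
open import Relation.Nullary using (yes; no)
open import Relation.Binary.PropositionalEquality

lookup-injective : ∀ {A : Set} {xs : List A} → Unique xs →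
                   ∀ i j → lookup xs i ≡ lookup xs j → i ≡ j
lookup-injective (_ ∷ _) zero zero _ = refl
lookup-injective {xs = _ ∷ xs} (x∉xs ∷ _) zero (suc j) x≡ =
  ⊥-elim (All.lookup x∉xs (∈-lookup {xs = xs} j) x≡)
lookup-injective {xs = _ ∷ xs} (x∉xs ∷ _) (suc i) zero ≡x =
  ⊥-elim (All.lookup x∉xs (∈-lookup {xs = xs} i) (sym ≡x))
lookup-injective (_ ∷ unique) (suc i) (suc j) eq = cong suc (lookup-injective unique i j eq)

cast-injective : ∀ {a b} .(eq : a ≡ b) (i j : Fin a) → cast eq i ≡ cast eq j → i ≡ j
cast-injective eq i j ci≡cj =
  toℕ-injective (trans (sym (toℕ-cast eq i)) (trans (cong toℕ ci≡cj) (toℕ-cast eq j)))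

module _ {k : ℕ} (f : Fin k → ℕ) where

  position : ℕ → Maybe (Fin k)
  position x with any? (λ d → f d ≟ x)
  ... | yes (d , _) = just d
  ... | no _        = nothing

  position-sound : ∀ x d → position x ≡ just d → f d ≡ x
  position-sound x d found with any? (λ d → f d ≟ x)
  position-sound x d refl | yes (.d , fd≡x) = fd≡x
  position-sound x d ()   | no _

  position-complete : (∀ c d → f c ≡ f d → c ≡ d) → ∀ x d → f d ≡ x → position x ≡ just d
  position-complete f-inj x d fd≡x with any? (λ d → f d ≟ x)
  ... | yes (d′ , fd′≡x) = cong just (f-inj d′ d (trans fd′≡x (sym fd≡x)))
  ... | no none          = ⊥-elim (none (d , fd≡x))

module _ {G : OGraph} where

  _++ᵂ_ : ∀ {u v w} → Walk G u v → Walk G v w → Walk G u w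
  []      ++ᵂ W′ = W′
  fwd e W ++ᵂ W′ = fwd e (W ++ᵂ W′)
  bwd e W ++ᵂ W′ = bwd e (W ++ᵂ W′)

  walkMap-++ : ∀ {k} {C : CorrAssignment G k} {u v w} {W : Walk G u v} {W′ : Walk G v w} {c d d′} →
               WalkMap C W c d → WalkMap C W′ d d′ → WalkMap C (W ++ᵂ W′) c d′
  walkMap-++ []        M′ = M′
  walkMap-++ (fwd p M) M′ = fwd p (walkMap-++ M M′)
  walkMap-++ (bwd p M) M′ = bwd p (walkMap-++ M M′)

module Labellings (G : OGraph) (k : ℕ) where

  Labelling : Set
  Labelling = Fin (n G) → Fin k → ℕ

  Faithful : Labelling → Set
  Faithful lab = ∀ (v : Fin (n G)) c d → lab v c ≡ lab v d → c ≡ d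

  Respects : CorrAssignment G k → Labelling → Set
  Respects C lab = ∀ e c d → fun (C e) c ≡ just d → lab (tail G e) c ≡ lab (head G e) d

  labelLists : Labelling → Fin (n G) → List ℕ
  labelLists lab v = map (lab v) (allFin k)

  labelLists-unique : ∀ lab → Faithful lab → ∀ v → Unique (labelLists lab v)
  labelLists-unique lab faithful v = map⁺ (faithful v _ _) (allFin⁺ k)

  labelLists-length : ∀ lab v → length (labelLists lab v) ≡ k
  labelLists-length lab v = trans (length-map (lab v) (allFin k)) (length-tabulate (λ c → c))

  colourable-from-labelling : (C : CorrAssignment G k) (lab : Labelling) →
    Faithful lab → Respects C lab → Choosable G k → CColorable {G} {k} C
  colourable-from-labelling C lab faithful respects choosable
    with choosable (labelLists lab) (labelLists-unique lab faithful) (labelLists-length lab)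
  ... | g , g∈lists , g-proper = colouring , proper
    where
    chosen : ∀ v → ∃ λ c → c ∈ allFin k × g v ≡ lab v c
    chosen v = ∈-map⁻ (lab v) (g∈lists v)

    colouring : Fin (n G) → Fin k
    colouring v = proj₁ (chosen v)

    proper : IsCColoring {G} {k} C colouring
    proper e conflict = g-proper e (begin
      g (tail G e)                             ≡⟨ proj₂ (proj₂ (chosen (tail G e))) ⟩
      lab (tail G e) (colouring (tail G e))    ≡⟨ respects e _ _ conflict ⟩
      lab (head G e) (colouring (head G e))    ≡⟨ sym (proj₂ (proj₂ (chosen (head G e)))) ⟩
      g (head G e)                             ∎)
      where open ≡-Reasoning

  module Lifting (C : CorrAssignment G k) where

    V : Set
    V = Fin (n G)

    E : Set
    E = Fin (m G)

    Linked : V → Fin k → V → Fin k → Set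
    Linked v c w d = Σ (Walk G v w) λ W → WalkMap C W c d

    linked-trans : ∀ {u v w c d d′} → Linked u c v d → Linked v d w d′ → Linked u c w d′
    linked-trans (W , M) (W′ , M′) = W ++ᵂ W′ , walkMap-++ M M′

    linked-edge : ∀ e {c d} → fun (C e) c ≡ just d → Linked (tail G e) c (head G e) d
    linked-edge e p = fwd e [] , fwd p []

    linked-edge⁻¹ : ∀ e {c d} → fun (C e) c ≡ just d → Linked (head G e) d (tail G e) c
    linked-edge⁻¹ e p = bwd e [] , bwd p []

    linked-sym : ∀ {v w c d} → Linked v c w d → Linked w d v c
    linked-sym (_ , [])            = [] , []
    linked-sym (fwd e W , fwd p M) = linked-trans (linked-sym (W , M)) (linked-edge⁻¹ e p)
    linked-sym (bwd e W , bwd p M) = linked-trans (linked-sym (W , M)) (linked-edge e p)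

    Sound : Labelling → Set
    Sound lab = ∀ v c w d → lab v c ≡ lab w d → Linked v c w d

    -- Consistency is exactly what makes a sound labelling faithful.
    sound⇒faithful : Consistent {G} {k} C → ∀ lab → Sound lab → Faithful lab
    sound⇒faithful consistent lab sound v c d same with sound v c v d same
    ... | W , M = sym (consistent v W c d M)

    -- An injective labelling is sound: it only identifies a pair with itself.
    initial : Labelling
    initial v c = toℕ (combine v c)

    initial-sound : Sound initial
    initial-sound v c w d same with combine-injective v c w d (toℕ-injective same)
    ... | refl , refl = [] , []

    merge : ℕ → ℕ → ℕ → ℕ
    merge a b x with x ≟ b
    ... | yes _ = a
    ... | no _  = x

    merge-a : ∀ a b → merge a b a ≡ a
    merge-a a b with a ≟ b
    ... | yes _ = refl
    ... | no _  = refl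

    merge-b : ∀ a b → merge a b b ≡ a
    merge-b a b with b ≟ b
    ... | yes _   = refl
    ... | no b≢b = ⊥-elim (b≢b refl)

    merge-collapse : ∀ a b x y → merge a b x ≡ merge a b y →
                     x ≡ y ⊎ (x ≡ b × y ≡ a) ⊎ (x ≡ a × y ≡ b)
    merge-collapse a b x y eq with x ≟ b | y ≟ b
    ... | yes x≡b | yes y≡b = inj₁ (trans x≡b (sym y≡b))
    ... | yes x≡b | no _    = inj₂ (inj₁ (x≡b , sym eq))
    ... | no _    | yes y≡b = inj₂ (inj₂ (eq , y≡b))
    ... | no _    | no _    = inj₁ eq

    identify : Labelling → V → Fin k → V → Fin k → Labelling
    identify lab v c w d u x = merge (lab v c) (lab w d) (lab u x)

    identify-joins : ∀ lab v c w d → identify lab v c w d v c ≡ identify lab v c w d w d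
    identify-joins lab v c w d = trans (merge-a (lab v c) (lab w d)) (sym (merge-b (lab v c) (lab w d)))

    identify-sound : ∀ lab {v c w d} → Sound lab → Linked v c w d → Sound (identify lab v c w d)
    identify-sound lab {v} {c} {w} {d} sound link u x u′ x′ same
      with merge-collapse (lab v c) (lab w d) (lab u x) (lab u′ x′) same
    ... | inj₁ eq = sound u x u′ x′ eq
    ... | inj₂ (inj₁ (≡b , ≡a)) =
      linked-trans (sound u x w d ≡b) (linked-trans (linked-sym link) (sound v c u′ x′ (sym ≡a)))
    ... | inj₂ (inj₂ (≡a , ≡b)) =
      linked-trans (sound u x v c ≡a) (linked-trans link (sound w d u′ x′ (sym ≡b)))

    glue : E × Fin k → Labelling → Labelling
    glue (e , c) lab with fun (C e) c
    ... | nothing = lab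
    ... | just d  = identify lab (tail G e) c (head G e) d

    Coarsening : (Labelling → Labelling) → Set
    Coarsening F = ∀ lab v c w d → lab v c ≡ lab w d → F lab v c ≡ F lab w d

    glue-coarsening : ∀ p → Coarsening (glue p)
    glue-coarsening (e , c) lab u x u′ x′ same with fun (C e) c
    ... | nothing = same
    ... | just d  = cong (merge (lab (tail G e) c) (lab (head G e) d)) same

    glue-sound : ∀ p lab → Sound lab → Sound (glue p lab)
    glue-sound (e , c) lab sound with fun (C e) c in C-e-c
    ... | nothing = sound
    ... | just d  = identify-sound lab sound (linked-edge e C-e-c)

    glue-respects : ∀ e c d lab → fun (C e) c ≡ just d →
                    glue (e , c) lab (tail G e) c ≡ glue (e , c) lab (head G e) d
    glue-respects e c d lab C-e-c with fun (C e) c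
    glue-respects e c d lab refl | just .d = identify-joins lab (tail G e) c (head G e) d

    glueAll : List (E × Fin k) → Labelling → Labelling
    glueAll []       lab = lab
    glueAll (p ∷ ps) lab = glueAll ps (glue p lab)

    glueAll-coarsening : ∀ ps → Coarsening (glueAll ps)
    glueAll-coarsening []       lab v c w d same = same
    glueAll-coarsening (p ∷ ps) lab v c w d same =
      glueAll-coarsening ps (glue p lab) v c w d (glue-coarsening p lab v c w d same)

    glueAll-sound : ∀ ps lab → Sound lab → Sound (glueAll ps lab)
    glueAll-sound []       lab sound = sound
    glueAll-sound (p ∷ ps) lab sound = glueAll-sound ps (glue p lab) (glue-sound p lab sound)

    glueAll-respects : ∀ ps lab e c d → (e , c) ∈ ps → fun (C e) c ≡ just d →
                       glueAll ps lab (tail G e) c ≡ glueAll ps lab (head G e) d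
    glueAll-respects (_ ∷ ps) lab e c d (here refl) C-e-c =
      glueAll-coarsening ps (glue (e , c) lab) _ _ _ _ (glue-respects e c d lab C-e-c)
    glueAll-respects (p ∷ ps) lab e c d (there mem) C-e-c =
      glueAll-respects ps (glue p lab) e c d mem C-e-c

    consistent⇒labelling : Consistent {G} {k} C →
                           Σ Labelling λ lab → Faithful lab × Respects C lab
    consistent⇒labelling consistent =
      lab , sound⇒faithful consistent lab (glueAll-sound pairs initial initial-sound) , respects
      where
      pairs : List (E × Fin k)
      pairs = cartesianProduct (allFin (m G)) (allFin k)

      lab : Labelling
      lab = glueAll pairs initial

      respects : Respects C lab
      respects e c d = glueAll-respects pairs initial e c d
                         (∈-cartesianProduct⁺ (∈-allFin e) (∈-allFin c))

  module Induced (lab : Labelling) (faithful : Faithful lab) where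

    C : CorrAssignment G k
    C e = record
      { fun = λ c → position (lab (head G e)) (lab (tail G e) c)
      ; inj = λ a b d a↦d b↦d → faithful (tail G e) a b
          (trans (sym (position-sound (lab (head G e)) _ d a↦d))
                 (position-sound (lab (head G e)) _ d b↦d))
      }

    walk-preserves : ∀ {u v} {W : Walk G u v} {c d} → WalkMap C W c d → lab u c ≡ lab v d
    walk-preserves []                      = refl
    walk-preserves {W = fwd e _} (fwd p M) =
      trans (sym (position-sound (lab (head G e)) _ _ p)) (walk-preserves M)
    walk-preserves {W = bwd e _} (bwd p M) =
      trans (position-sound (lab (head G e)) _ _ p) (walk-preserves M)

    consistent : Consistent {G} {k} C
    consistent u W c d M = sym (faithful u c d (walk-preserves M))

    colouring-separates : ∀ f → IsCColoring {G} {k} C f →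
                          ∀ e → lab (tail G e) (f (tail G e)) ≢ lab (head G e) (f (head G e))
    colouring-separates f proper e same =
      proper e (position-complete (lab (head G e)) (faithful (head G e)) _ _ (sym same))

  listLabelling : (L : Fin (n G) → List ℕ) → (∀ v → length (L v) ≡ k) → Labelling
  listLabelling L len v c = lookup (L v) (cast (sym (len v)) c)

  listLabelling-faithful : (L : Fin (n G) → List ℕ) (len : ∀ v → length (L v) ≡ k) →
                           (∀ v → Unique (L v)) → Faithful (listLabelling L len)
  listLabelling-faithful L len unique v c d same =
    cast-injective (sym (len v)) c d (lookup-injective (unique v) _ _ same)

lemma2 : (G : OGraph) (k : ℕ) → 1 ≤ k →
    (Choosable G k → ((C : CorrAssignment G k) → Consistent {G} {k} C → CColorable {G} {k} C)) ×
    (((C : CorrAssignment G k) → Consistent {G} {k} C → CColorable {G} {k} C) → Choosable G k)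
lemma2 G k _ = choosable⇒colourable , colourable⇒choosable
  where
  open Labellings G k

  choosable⇒colourable : Choosable G k →
    (C : CorrAssignment G k) → Consistent {G} {k} C → CColorable {G} {k} C
  choosable⇒colourable choosable C consistent =
    let (lab , faithful , respects) = Lifting.consistent⇒labelling C consistent
    in colourable-from-labelling C lab faithful respects choosable

  colourable⇒choosable :
    ((C : CorrAssignment G k) → Consistent {G} {k} C → CColorable {G} {k} C) → Choosable G k
  colourable⇒choosable colourable L unique len =
    (λ v → lab v (f v)) , (λ v → ∈-lookup {xs = L v} _) , Induced.colouring-separates lab faithful f proper
    where
    lab : Labelling
    lab = listLabelling L len

    faithful : Faithful lab
    faithful = listLabelling-faithful L len unique

    colouring : CColorable {G} {k} (Induced.C lab faithful)
    colouring = colourable (Induced.C lab faithful) (Induced.consistent lab faithful)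

    f : Fin (n G) → Fin k
    f = proj₁ colouring

    proper : IsCColoring {G} {k} (Induced.C lab faithful) f
    proper = proj₂ colouring
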